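{- Let $P,Q\in\mathbb Z$ with $Q\ne0$, $f(t)=t^2-Pt+Q$, $D=P^2-4Q\ne0$, let $p$ be a prime with $p\nmid Q$, and let $r(p)$ be the rank of the Lucas sequence. Then in $G_{\mathbb Q}(f)$, $$G(f,p)\cap\langle[0:1]\rangle=\langle[0:1]^{r(p)}\rangle.$$
   Context: $G_{\mathbb Q}(f)$: rational sequences $(w_n)_{n\in\mathbb Z}$ with $w_{n+2}-Pw_{n+1}+Qw_n=0$ and $w_1^2-Pw_0w_1+Qw_0^2\ne0$, with product $(w_n)*(v_n)=(u_n)$, $u_1=w_1v_1-Qw_0v_0$, $u_0=w_0v_1+w_1v_0-Pw_0v_0$, modulo multiplication by elements of $\mathbb Q^\times$; $[w_1:w_0]$ is the class with initial terms $w_1,w_0$. $G(f,p)$ is the set of classes $[w_1:w_0]$ which, for a representative with $w_0,w_1\in\mathbb Z$ coprime, satisfy $p\mid w_0$ (i.e. reduce to $[1:0]\in\mathbb P^1(\mathbb F_p)$). The Lucas sequence has $\mathcal F_0=0,\mathcal F_1=1$ and the same recurrence; its rank $r(p)$ is the least positive $n$ with $\mathcal F_n\in p\mathbb Z_{(p)}$. -}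

module Defs where

open import Data.Nat as ℕ using (ℕ; zero; suc)
open import Data.Nat.Coprimality using (Coprime)
open import Data.Integer as ℤ using (ℤ; +_)
open import Data.Integer.Divisibility as ℤD using ()
open import Data.Rational as ℚ using (ℚ; 0ℚ; 1ℚ; _/_)
open import Data.Product using (_×_; Σ; ∃; _,_)
open import Data.Sum using (_⊎_)
open import Relation.Nullary using (¬_)
open import Relation.Binary.PropositionalEquality using (_≡_)

-- An element of G_Q(f) is represented by its initial terms (w₁ , w₀):
-- a sequence satisfying the (invertible, Q ≠ 0) recurrence is determined
-- by them. Classes [w₁ : w₀] are handled via the equivalence _∼_ below.
Pair : Set
Pair = ℚ × ℚ

_∼_ : Pair → Pair → Set
(w₁ , w₀) ∼ (v₁ , v₀) = Σ ℚ λ c → ¬ (c ≡ 0ℚ) × (w₁ ≡ c ℚ.* v₁) × (w₀ ≡ c ℚ.* v₀)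

module _ (P Q : ℤ) where
  Pℚ Qℚ : ℚ
  Pℚ = P / 1
  Qℚ = Q / 1

  norm : Pair → ℚ
  norm (w₁ , w₀) = (w₁ ℚ.* w₁ ℚ.- Pℚ ℚ.* w₀ ℚ.* w₁) ℚ.+ Qℚ ℚ.* w₀ ℚ.* w₀

  mul : Pair → Pair → Pair
  mul (w₁ , w₀) (v₁ , v₀) =
    (w₁ ℚ.* v₁ ℚ.- Qℚ ℚ.* w₀ ℚ.* v₀) ,
    ((w₀ ℚ.* v₁ ℚ.+ w₁ ℚ.* v₀) ℚ.- Pℚ ℚ.* w₀ ℚ.* v₀)

  one : Pair
  one = (1ℚ , 0ℚ)

  pow : Pair → ℕ → Pair
  pow x zero    = one
  pow x (suc n) = mul x (pow x n)

  -- x ∈ ⟨g⟩ in G_Q(f): x = g^n or x⁻¹ = g^n (i.e. x * g^n = 1) for some n ∈ ℕ,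
  -- everything up to the class equivalence
  InCyclic : Pair → Pair → Set
  InCyclic g x = ∃ λ (n : ℕ) → (x ∼ pow g n) ⊎ (mul x (pow g n) ∼ one)

  lucas : ℕ → ℤ
  lucas zero          = + 0
  lucas (suc zero)    = + 1
  lucas (suc (suc n)) = P ℤ.* lucas (suc n) ℤ.- Q ℤ.* lucas n

  IsRank : ℕ → ℕ → Set
  IsRank p r = (0 ℕ.< r) × ((+ p) ℤD.∣ lucas r)
             × (∀ m → 0 ℕ.< m → m ℕ.< r → ¬ ((+ p) ℤD.∣ lucas m))



InGfp : ℕ → Pair → Set
InGfp p x = Σ ℤ λ a → Σ ℤ λ b →
  Coprime (ℤ.∣ a ∣) (ℤ.∣ b ∣) × (x ∼ (a / 1 , b / 1)) × ((+ p) ℤD.∣ b)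

-- Clearing denominators, [0:1]ⁿ has the integral representative Gₙ = (G₁ n , G₀ n),
-- where G₀ n = ±Fₙ and, because p ∤ Q, p never divides both entries. The inverse
-- of [0:1]ⁿ is represented by the conjugate (G₁ n - P G₀ n , - G₀ n), as the norm
-- of Gₙ is Qⁿ ≠ 0. A class with a p-primitive integral representative W lies in
-- G(f,p) iff p ∣ W₀, so x = [0:1]^{±n} lies in G(f,p) iff p ∣ Fₙ. It remains that
-- p ∣ Fₙ iff r(p) ∣ n: once p ∣ F_m, the w₀-coordinate of G_{m+s} = G_m G_s is
-- G₁ m · G₀ s mod p with p ∤ G₁ m, so p ∣ F_{m+s} iff p ∣ F_s; divide n by r(p)
-- and use minimality.

module Submission where

open import Defs
open import Data.Nat using (ℕ)
open import Data.Nat.Primality using (Prime)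
open import Data.Integer using (ℤ; +_; _*_; _-_)
open import Data.Integer.Divisibility using (_∣_)
open import Data.Rational using (0ℚ; 1ℚ)
open import Data.Product using (_×_; _,_)
open import Function.Bundles using (_⇔_)
open import Relation.Nullary using (¬_)
open import Relation.Binary.PropositionalEquality using (_≡_)

open import Data.Nat as ℕ using (zero; suc; z≤n; s≤s)
import Data.Nat.Properties as ℕ
import Data.Nat.Divisibility as ℕ
import Data.Nat.DivMod as ℕ
open import Data.Nat.GCD using (gcd; gcd[m,n]∣m; gcd[m,n]∣n; gcd[m,n]≢0)
open import Data.Nat.Coprimality as Coprimality using (Coprime; coprime-/gcd)
open import Data.Nat.Primality using (euclidsLemma; prime⇒nonTrivial)
open import Data.Integer as ℤ using (_+_; -_; ∣_∣)
import Data.Integer.Properties as ℤ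
open import Data.Integer.Divisibility.Signed
  using (divides; ∣ᵤ⇒∣; ∣⇒∣ᵤ; ∣m⇒∣-m; ∣m∣n⇒∣m+n; ∣m+n∣n⇒∣m; ∣n⇒∣m*n; ∣m⇒∣m*n)
  renaming (_∣_ to _∣ₛ_)
import Data.Integer.Tactic.RingSolver as ℤ
open import Data.Rational as ℚ using (ℚ; ↥_; ↧_)
import Data.Rational.Properties as ℚ
import Data.Rational.Unnormalised as ℚᵘ
import Data.Rational.Unnormalised.Properties as ℚᵘ
open import Data.Product using (∃; proj₁; proj₂)
open import Data.Sum as Sum using (_⊎_; inj₁; inj₂; [_,_]′)
open import Data.Empty using (⊥-elim)
open import Data.Maybe.Base using (Maybe; just; nothing)
open import Function.Base using (id)
open import Function.Bundles using (mk⇔; Equivalence)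
open import Function.Construct.Composition using (_⇔-∘_)
open import Relation.Nullary using (yes; no)
open import Relation.Binary.PropositionalEquality
  using (_≢_; refl; sym; trans; cong; cong₂; subst; subst₂; module ≡-Reasoning)
open import Tactic.RingSolver using (solve-∀)
import Tactic.RingSolver.Core.AlmostCommutativeRing as ACR

ℚ-ring : ACR.AlmostCommutativeRing _ _
ℚ-ring = ACR.fromCommutativeRing ℚ.+-*-commutativeRing isZero
  where
  isZero : (x : ℚ) → Maybe (0ℚ ≡ x)
  isZero x with 0ℚ ℚ.≟ x
  ... | yes 0≡x = just 0≡x
  ... | no _    = nothing

ι : ℤ → ℚ
ι z = z ℚ./ 1

toℚᵘ-ι : ∀ z → ℚ.toℚᵘ (ι z) ℚᵘ.≃ ℚᵘ.mkℚᵘ z 0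
toℚᵘ-ι z = ℚ.toℚᵘ-fromℚᵘ (ℚᵘ.mkℚᵘ z 0)

ι-homo-* : ∀ a b → ι (a * b) ≡ ι a ℚ.* ι b
ι-homo-* a b = ℚ.toℚᵘ-injective (begin
  ℚ.toℚᵘ (ι (a * b))              ≈⟨ toℚᵘ-ι (a * b) ⟩
  ℚᵘ.mkℚᵘ (a * b) 0               ≈⟨ ℚᵘ.*≡* refl ⟩
  ℚᵘ.mkℚᵘ a 0 ℚᵘ.* ℚᵘ.mkℚᵘ b 0    ≈⟨ ℚᵘ.*-cong (toℚᵘ-ι a) (toℚᵘ-ι b) ⟨
  ℚ.toℚᵘ (ι a) ℚᵘ.* ℚ.toℚᵘ (ι b)  ≈⟨ ℚ.toℚᵘ-homo-* (ι a) (ι b) ⟨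
  ℚ.toℚᵘ (ι a ℚ.* ι b)            ∎)
  where open ℚᵘ.≃-Reasoning

ι-homo-+ : ∀ a b → ι (a + b) ≡ ι a ℚ.+ ι b
ι-homo-+ a b = ℚ.toℚᵘ-injective (begin
  ℚ.toℚᵘ (ι (a + b))              ≈⟨ toℚᵘ-ι (a + b) ⟩
  ℚᵘ.mkℚᵘ (a + b) 0               ≈⟨ ℚᵘ.*≡* (cross a b) ⟩
  ℚᵘ.mkℚᵘ a 0 ℚᵘ.+ ℚᵘ.mkℚᵘ b 0    ≈⟨ ℚᵘ.+-cong (toℚᵘ-ι a) (toℚᵘ-ι b) ⟨
  ℚ.toℚᵘ (ι a) ℚᵘ.+ ℚ.toℚᵘ (ι b)  ≈⟨ ℚ.toℚᵘ-homo-+ (ι a) (ι b) ⟨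
  ℚ.toℚᵘ (ι a ℚ.+ ι b)            ∎)
  where
  open ℚᵘ.≃-Reasoning
  cross : ∀ a b → (a + b) * + 1 ≡ (a * + 1 + b * + 1) * + 1
  cross = ℤ.solve-∀

ι-homo‿- : ∀ a → ι (- a) ≡ ℚ.- ι a
ι-homo‿- a = ℚ.toℚᵘ-injective (begin
  ℚ.toℚᵘ (ι (- a))        ≈⟨ toℚᵘ-ι (- a) ⟩
  ℚᵘ.- ℚᵘ.mkℚᵘ a 0        ≈⟨ ℚᵘ.-‿cong (toℚᵘ-ι a) ⟨
  ℚᵘ.- ℚ.toℚᵘ (ι a)       ≈⟨ ℚ.toℚᵘ-homo‿- (ι a) ⟨
  ℚ.toℚᵘ (ℚ.- ι a)        ∎)
  where open ℚᵘ.≃-Reasoning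

ι-homo-- : ∀ a b → ι (a - b) ≡ ι a ℚ.- ι b
ι-homo-- a b = trans (ι-homo-+ a (- b)) (cong (ι a ℚ.+_) (ι-homo‿- b))

ι-homo-*₃ : ∀ a b c → ι (a * b * c) ≡ ι a ℚ.* ι b ℚ.* ι c
ι-homo-*₃ a b c = trans (ι-homo-* (a * b) c) (cong (ℚ._* ι c) (ι-homo-* a b))

ι-injective : ∀ {a b} → ι a ≡ ι b → a ≡ b
ι-injective {a} {b} ιa≡ιb = begin
  a        ≡⟨ ℤ.*-identityʳ a ⟨
  a * + 1  ≡⟨ ℚᵘ.drop-*≡* (ℚᵘ.≃-trans (ℚᵘ.≃-sym (toℚᵘ-ι a))
                (ℚᵘ.≃-trans (ℚ.toℚᵘ-cong ιa≡ιb) (toℚᵘ-ι b))) ⟩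
  b * + 1  ≡⟨ ℤ.*-identityʳ b ⟩
  b        ∎
  where open ≡-Reasoning

ι-cross : ∀ d a b → d ℚ.* ι a ≡ ι b → ↥ d * a ≡ b * ↧ d
ι-cross d@record{} a b d*ιa≡ιb = begin
  ↥ d * a          ≡⟨ ℤ.*-identityʳ (↥ d * a) ⟨
  ↥ d * a * + 1    ≡⟨ ℚᵘ.drop-*≡* (ℚᵘ.≃-trans (ℚᵘ.≃-sym toℚᵘ[d*ιa])
                        (ℚᵘ.≃-trans (ℚ.toℚᵘ-cong d*ιa≡ιb) (toℚᵘ-ι b))) ⟩
  b * (↧ d * + 1)  ≡⟨ cong (b *_) (ℤ.*-identityʳ (↧ d)) ⟩
  b * ↧ d          ∎
  where
  open ≡-Reasoning
  toℚᵘ[d*ιa] : ℚ.toℚᵘ (d ℚ.* ι a) ℚᵘ.≃ ℚ.toℚᵘ d ℚᵘ.* ℚᵘ.mkℚᵘ a 0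
  toℚᵘ[d*ιa] =
    ℚᵘ.≃-trans (ℚ.toℚᵘ-homo-* d (ι a)) (ℚᵘ.*-congˡ {ℚ.toℚᵘ d} (toℚᵘ-ι a))

1ℚ≢0ℚ : 1ℚ ≢ 0ℚ
1ℚ≢0ℚ ()

*-≢0 : ∀ {c d} → c ≢ 0ℚ → d ≢ 0ℚ → c ℚ.* d ≢ 0ℚ
*-≢0 {c} {d} c≢0 d≢0 cd≡0 =
  [ (λ ↥c≡0 → c≢0 (ℚ.↥p≡0⇒p≡0 c ↥c≡0))
  , (λ ↥d≡0 → d≢0 (ℚ.↥p≡0⇒p≡0 d ↥d≡0)) ]′
    (ℤ.i*j≡0⇒i≡0∨j≡0 (↥ c) (zero-product (ℚ.p≡0⇒↥p≡0 _ cd≡0) (ℚ.↥-* c d)))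
  where
  zero-product : ∀ {i j k} → i ≡ + 0 → i * j ≡ k → k ≡ + 0
  zero-product {j = j} refl i*j≡k = trans (sym i*j≡k) (ℤ.*-zeroˡ j)

inverse : ∀ {c} → c ≢ 0ℚ → ∃ λ c⁻¹ → c⁻¹ ≢ 0ℚ × c⁻¹ ℚ.* c ≡ 1ℚ
inverse {c} c≢0 = ℚ.1/ c , 1/c≢0 , ℚ.*-inverseˡ c
  where
  instance
    c-nonZero : ℚ.NonZero c
    c-nonZero = ℚ.≢-nonZero c≢0
  1/c≢0 : ℚ.1/ c ≢ 0ℚ
  1/c≢0 1/c≡0 = 1ℚ≢0ℚ (begin
    1ℚ              ≡⟨ ℚ.*-inverseˡ c ⟨
    ℚ.1/ c ℚ.* c    ≡⟨ cong (ℚ._* c) 1/c≡0 ⟩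
    0ℚ ℚ.* c        ≡⟨ ℚ.*-zeroˡ c ⟩
    0ℚ              ∎)
    where open ≡-Reasoning

infixr 7 _·_

_·_ : ℚ → Pair → Pair
c · (w₁ , w₀) = c ℚ.* w₁ , c ℚ.* w₀

·-assoc : ∀ a b x → a · (b · x) ≡ (a ℚ.* b) · x
·-assoc a b (x₁ , x₀) = cong₂ _,_ (sym (ℚ.*-assoc a b x₁)) (sym (ℚ.*-assoc a b x₀))

·-identityˡ : ∀ x → 1ℚ · x ≡ x
·-identityˡ (x₁ , x₀) = cong₂ _,_ (ℚ.*-identityˡ x₁) (ℚ.*-identityˡ x₀)

·⇒∼ : ∀ {c x y} → c ≢ 0ℚ → x ≡ c · y → x ∼ y
·⇒∼ c≢0 refl = _ , c≢0 , refl , refl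

∼⇒· : ∀ {x y} (x∼y : x ∼ y) → x ≡ proj₁ x∼y · y
∼⇒· (_ , _ , x₁≡ , x₀≡) = cong₂ _,_ x₁≡ x₀≡

·-cancel-∼ : ∀ {a b x y} → a ≢ 0ℚ → b ≢ 0ℚ → a · x ≡ b · y → x ∼ y
·-cancel-∼ {a} {b} {x} {y} a≢0 b≢0 ax≡by with inverse a≢0
... | a⁻¹ , a⁻¹≢0 , a⁻¹a≡1 = ·⇒∼ (*-≢0 a⁻¹≢0 b≢0) (begin
  x                 ≡⟨ ·-identityˡ x ⟨
  1ℚ · x            ≡⟨ cong (_· x) a⁻¹a≡1 ⟨
  (a⁻¹ ℚ.* a) · x   ≡⟨ ·-assoc a⁻¹ a x ⟨
  a⁻¹ · (a · x)     ≡⟨ cong (a⁻¹ ·_) ax≡by ⟩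
  a⁻¹ · (b · y)     ≡⟨ ·-assoc a⁻¹ b y ⟩
  (a⁻¹ ℚ.* b) · y   ∎)
  where open ≡-Reasoning

∼-sym : ∀ {x y} → x ∼ y → y ∼ x
∼-sym {x} {y} x∼y@(c , c≢0 , _) =
  ·-cancel-∼ c≢0 1ℚ≢0ℚ (trans (sym (∼⇒· x∼y)) (sym (·-identityˡ x)))

∼-trans : ∀ {x y z} → x ∼ y → y ∼ z → x ∼ z
∼-trans {z = z} x∼y@(c , c≢0 , _) y∼z@(d , d≢0 , _) =
  ·⇒∼ (*-≢0 c≢0 d≢0) (trans (∼⇒· x∼y) (trans (cong (c ·_) (∼⇒· y∼z)) (·-assoc c d z)))

ℤ² : Set
ℤ² = ℤ × ℤ

embed : ℤ² → Pair
embed (a , b) = ι a , ι b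

module Lucas (P Q : ℤ) where

  g : Pair
  g = 0ℚ , 1ℚ

  conj : Pair → Pair
  conj (v₁ , v₀) = v₁ ℚ.- ι P ℚ.* v₀ , ℚ.- v₀

  _∼_^±1 : Pair → Pair → Set
  x ∼ y ^±1 = (x ∼ y) ⊎ (mul P Q x y ∼ one P Q)

  mul-scaled-one : ∀ c y → mul P Q (c · one P Q) y ≡ c · y
  mul-scaled-one c (y₁ , y₀) = cong₂ _,_ (first c y₁ y₀ (ι Q)) (second c y₁ y₀ (ι P))
    where
    first : ∀ c y₁ y₀ q → c ℚ.* 1ℚ ℚ.* y₁ ℚ.- q ℚ.* (c ℚ.* 0ℚ) ℚ.* y₀ ≡ c ℚ.* y₁
    first = solve-∀ ℚ-ring
    second : ∀ c y₁ y₀ p →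
      (c ℚ.* 0ℚ ℚ.* y₁ ℚ.+ c ℚ.* 1ℚ ℚ.* y₀) ℚ.- p ℚ.* (c ℚ.* 0ℚ) ℚ.* y₀ ≡ c ℚ.* y₀
    second = solve-∀ ℚ-ring

  mul-mul-conj : ∀ x v → mul P Q (mul P Q x v) (conj v) ≡ norm P Q v · x
  mul-mul-conj (x₁ , x₀) (v₁ , v₀) =
    cong₂ _,_ (first x₁ x₀ v₁ v₀ (ι P) (ι Q)) (second x₁ x₀ v₁ v₀ (ι P) (ι Q))
    where
    first : ∀ x₁ x₀ v₁ v₀ p q →
      (x₁ ℚ.* v₁ ℚ.- q ℚ.* x₀ ℚ.* v₀) ℚ.* (v₁ ℚ.- p ℚ.* v₀)
        ℚ.- q ℚ.* ((x₀ ℚ.* v₁ ℚ.+ x₁ ℚ.* v₀) ℚ.- p ℚ.* x₀ ℚ.* v₀) ℚ.* (ℚ.- v₀)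
      ≡ ((v₁ ℚ.* v₁ ℚ.- p ℚ.* v₀ ℚ.* v₁) ℚ.+ q ℚ.* v₀ ℚ.* v₀) ℚ.* x₁
    first = solve-∀ ℚ-ring
    second : ∀ x₁ x₀ v₁ v₀ p q →
      ((x₀ ℚ.* v₁ ℚ.+ x₁ ℚ.* v₀) ℚ.- p ℚ.* x₀ ℚ.* v₀) ℚ.* (v₁ ℚ.- p ℚ.* v₀)
        ℚ.+ (x₁ ℚ.* v₁ ℚ.- q ℚ.* x₀ ℚ.* v₀) ℚ.* (ℚ.- v₀)
        ℚ.- p ℚ.* ((x₀ ℚ.* v₁ ℚ.+ x₁ ℚ.* v₀) ℚ.- p ℚ.* x₀ ℚ.* v₀) ℚ.* (ℚ.- v₀)
      ≡ ((v₁ ℚ.* v₁ ℚ.- p ℚ.* v₀ ℚ.* v₁) ℚ.+ q ℚ.* v₀ ℚ.* v₀) ℚ.* x₀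
    second = solve-∀ ℚ-ring

  mul∼one⇒∼conj : ∀ {x v} → mul P Q x v ∼ one P Q → norm P Q v ≢ 0ℚ → x ∼ conj v
  mul∼one⇒∼conj {x} {v} xv∼one@(c , c≢0 , _) Nv≢0 = ·-cancel-∼ Nv≢0 c≢0 (begin
    norm P Q v · x                       ≡⟨ mul-mul-conj x v ⟨
    mul P Q (mul P Q x v) (conj v)       ≡⟨ cong (λ y → mul P Q y (conj v)) (∼⇒· xv∼one) ⟩
    mul P Q (c · one P Q) (conj v)       ≡⟨ mul-scaled-one c (conj v) ⟩
    c · conj v                           ∎)
    where open ≡-Reasoning

  norm-mul : ∀ x y → norm P Q (mul P Q x y) ≡ norm P Q x ℚ.* norm P Q y
  norm-mul (x₁ , x₀) (y₁ , y₀) = multiplicative x₁ x₀ y₁ y₀ (ι P) (ι Q)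
    where
    multiplicative : ∀ x₁ x₀ y₁ y₀ p q →
      let w₁ = x₁ ℚ.* y₁ ℚ.- q ℚ.* x₀ ℚ.* y₀
          w₀ = (x₀ ℚ.* y₁ ℚ.+ x₁ ℚ.* y₀) ℚ.- p ℚ.* x₀ ℚ.* y₀
      in (w₁ ℚ.* w₁ ℚ.- p ℚ.* w₀ ℚ.* w₁) ℚ.+ q ℚ.* w₀ ℚ.* w₀
         ≡ ((x₁ ℚ.* x₁ ℚ.- p ℚ.* x₀ ℚ.* x₁) ℚ.+ q ℚ.* x₀ ℚ.* x₀)
           ℚ.* ((y₁ ℚ.* y₁ ℚ.- p ℚ.* y₀ ℚ.* y₁) ℚ.+ q ℚ.* y₀ ℚ.* y₀)
    multiplicative = solve-∀ ℚ-ring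

  norm-one : norm P Q (one P Q) ≡ 1ℚ
  norm-one = value (ι P) (ι Q)
    where
    value : ∀ p q → (1ℚ ℚ.* 1ℚ ℚ.- p ℚ.* 0ℚ ℚ.* 1ℚ) ℚ.+ q ℚ.* 0ℚ ℚ.* 0ℚ ≡ 1ℚ
    value = solve-∀ ℚ-ring

  norm-g : norm P Q g ≡ ι Q
  norm-g = value (ι P) (ι Q)
    where
    value : ∀ p q → (0ℚ ℚ.* 0ℚ ℚ.- p ℚ.* 1ℚ ℚ.* 0ℚ) ℚ.+ q ℚ.* 1ℚ ℚ.* 1ℚ ≡ q
    value = solve-∀ ℚ-ring

  norm-pow-g≢0 : Q ≢ + 0 → ∀ n → norm P Q (pow P Q g n) ≢ 0ℚ
  norm-pow-g≢0 Q≢0 zero    = subst (_≢ 0ℚ) (sym norm-one) 1ℚ≢0ℚ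
  norm-pow-g≢0 Q≢0 (suc n) = subst (_≢ 0ℚ) (sym N[gⁿ⁺¹]≡QN[gⁿ])
    (*-≢0 (λ ιQ≡0 → Q≢0 (ι-injective {Q} {+ 0} ιQ≡0)) (norm-pow-g≢0 Q≢0 n))
    where
    N[gⁿ⁺¹]≡QN[gⁿ] : norm P Q (pow P Q g (suc n)) ≡ ι Q ℚ.* norm P Q (pow P Q g n)
    N[gⁿ⁺¹]≡QN[gⁿ] =
      trans (norm-mul g (pow P Q g n)) (cong (ℚ._* norm P Q (pow P Q g n)) norm-g)

  mulℤ : ℤ² → ℤ² → ℤ²
  mulℤ (w₁ , w₀) (v₁ , v₀) =
    w₁ * v₁ - Q * w₀ * v₀ , (w₀ * v₁ + w₁ * v₀) - P * w₀ * v₀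

  oneℤ gℤ : ℤ²
  oneℤ = + 1 , + 0
  gℤ   = + 0 , + 1

  powℤ : ℤ² → ℕ → ℤ²
  powℤ X zero    = oneℤ
  powℤ X (suc n) = mulℤ X (powℤ X n)

  conjℤ : ℤ² → ℤ²
  conjℤ (v₁ , v₀) = v₁ - P * v₀ , - v₀

  mulℤ-assoc : ∀ X Y Z → mulℤ (mulℤ X Y) Z ≡ mulℤ X (mulℤ Y Z)
  mulℤ-assoc (a , b) (c , d) (e , f) = cong₂ _,_ (first P Q a b c d e f) (second P Q a b c d e f)
    where
    first : ∀ P Q a b c d e f →
      (a * c - Q * b * d) * e - Q * ((b * c + a * d) - P * b * d) * f
      ≡ a * (c * e - Q * d * f) - Q * b * ((d * e + c * f) - P * d * f)
    first = ℤ.solve-∀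
    second : ∀ P Q a b c d e f →
      (((b * c + a * d) - P * b * d) * e + (a * c - Q * b * d) * f)
        - P * ((b * c + a * d) - P * b * d) * f
      ≡ (b * (c * e - Q * d * f) + a * ((d * e + c * f) - P * d * f))
        - P * b * ((d * e + c * f) - P * d * f)
    second = ℤ.solve-∀

  mulℤ-identityˡ : ∀ X → mulℤ oneℤ X ≡ X
  mulℤ-identityˡ (c , d) = cong₂ _,_ (first P Q c d) (second P Q c d)
    where
    first : ∀ P Q c d → + 1 * c - Q * + 0 * d ≡ c
    first = ℤ.solve-∀
    second : ∀ P Q c d → (+ 0 * c + + 1 * d) - P * + 0 * d ≡ d
    second = ℤ.solve-∀

  gℤ-mulℤ : ∀ X → mulℤ gℤ X ≡ (- (Q * proj₂ X) , proj₁ X - P * proj₂ X)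
  gℤ-mulℤ (c , d) = cong₂ _,_ (first P Q c d) (second P Q c d)
    where
    first : ∀ P Q c d → + 0 * c - Q * + 1 * d ≡ - (Q * d)
    first = ℤ.solve-∀
    second : ∀ P Q c d → (+ 1 * c + + 0 * d) - P * + 1 * d ≡ c - P * d
    second = ℤ.solve-∀

  powℤ-+ : ∀ X m n → powℤ X (m ℕ.+ n) ≡ mulℤ (powℤ X m) (powℤ X n)
  powℤ-+ X zero    n = sym (mulℤ-identityˡ (powℤ X n))
  powℤ-+ X (suc m) n =
    trans (cong (mulℤ X) (powℤ-+ X m n)) (sym (mulℤ-assoc X (powℤ X m) (powℤ X n)))

  powℤ-* : ∀ X m n → powℤ (powℤ X m) n ≡ powℤ X (n ℕ.* m)
  powℤ-* X m zero    = refl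
  powℤ-* X m (suc n) =
    trans (cong (mulℤ (powℤ X m)) (powℤ-* X m n)) (sym (powℤ-+ X m (n ℕ.* m)))

  embed-mul : ∀ X Y → mul P Q (embed X) (embed Y) ≡ embed (mulℤ X Y)
  embed-mul (w₁ , w₀) (v₁ , v₀) = sym (cong₂ _,_
    (trans (ι-homo-- (w₁ * v₁) (Q * w₀ * v₀))
      (cong₂ ℚ._-_ (ι-homo-* w₁ v₁) (ι-homo-*₃ Q w₀ v₀)))
    (trans (ι-homo-- (w₀ * v₁ + w₁ * v₀) (P * w₀ * v₀)) (cong₂ ℚ._-_
      (trans (ι-homo-+ (w₀ * v₁) (w₁ * v₀))
        (cong₂ ℚ._+_ (ι-homo-* w₀ v₁) (ι-homo-* w₁ v₀)))
      (ι-homo-*₃ P w₀ v₀))))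

  embed-pow : ∀ X n → pow P Q (embed X) n ≡ embed (powℤ X n)
  embed-pow X zero    = refl
  embed-pow X (suc n) = trans (cong (mul P Q (embed X)) (embed-pow X n)) (embed-mul X (powℤ X n))

  embed-conj : ∀ V → conj (embed V) ≡ embed (conjℤ V)
  embed-conj (v₁ , v₀) = sym (cong₂ _,_
    (trans (ι-homo-- v₁ (P * v₀)) (cong (λ t → ι v₁ ℚ.- t) (ι-homo-* P v₀)))
    (ι-homo‿- v₀))

  G : ℕ → ℤ²
  G = powℤ gℤ

  G₁ G₀ : ℕ → ℤ
  G₁ n = proj₁ (G n)
  G₀ n = proj₂ (G n)

  pow-g : ∀ n → pow P Q g n ≡ embed (G n)
  pow-g = embed-pow gℤ

  pow-pow-g : ∀ m n → pow P Q (pow P Q g m) n ≡ pow P Q g (n ℕ.* m)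
  pow-pow-g m n = begin
    pow P Q (pow P Q g m) n    ≡⟨ cong (λ y → pow P Q y n) (pow-g m) ⟩
    pow P Q (embed (G m)) n    ≡⟨ embed-pow (G m) n ⟩
    embed (powℤ (G m) n)       ≡⟨ cong embed (powℤ-* gℤ m n) ⟩
    embed (G (n ℕ.* m))        ≡⟨ pow-g (n ℕ.* m) ⟨
    pow P Q g (n ℕ.* m)        ∎
    where open ≡-Reasoning

  G₀-recurrence : ∀ n → G₀ (suc (suc n)) ≡ - (Q * G₀ n) - P * G₀ (suc n)
  G₀-recurrence n = trans (cong proj₂ (gℤ-mulℤ (G (suc n))))
                          (cong (_- P * G₀ (suc n)) (cong proj₁ (gℤ-mulℤ (G n))))

  G₀-lucas : ∀ n → ∃ λ σ → ∣ σ ∣ ≡ 1 × G₀ n ≡ σ * lucas P Q n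
                                      × G₀ (suc n) ≡ - σ * lucas P Q (suc n)
  G₀-lucas zero    = ℤ.-1ℤ , refl , refl , trans (cong proj₂ (gℤ-mulℤ oneℤ)) (G₀[1] P)
    where
    G₀[1] : ∀ P → + 1 - P * + 0 ≡ + 1
    G₀[1] = ℤ.solve-∀
  G₀-lucas (suc n) with G₀-lucas n
  ... | σ , ∣σ∣≡1 , G₀[n] , G₀[1+n] = - σ , trans (ℤ.∣-i∣≡∣i∣ σ) ∣σ∣≡1 , G₀[1+n] , (begin
    G₀ (suc (suc n))                   ≡⟨ G₀-recurrence n ⟩
    - (Q * G₀ n) - P * G₀ (suc n)      ≡⟨ cong₂ (λ u v → - (Q * u) - P * v) G₀[n] G₀[1+n] ⟩
    - (Q * (σ * F₀)) - P * (- σ * F₁)  ≡⟨ step P Q σ F₀ F₁ ⟩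
    - - σ * (P * F₁ - Q * F₀)          ∎)
    where
    open ≡-Reasoning
    F₀ F₁ : ℤ
    F₀ = lucas P Q n
    F₁ = lucas P Q (suc n)
    step : ∀ P Q σ F₀ F₁ → - (Q * (σ * F₀)) - P * (- σ * F₁) ≡ - - σ * (P * F₁ - Q * F₀)
    step = ℤ.solve-∀

  ∣G₀∣≡∣lucas∣ : ∀ n → ∣ G₀ n ∣ ≡ ∣ lucas P Q n ∣
  ∣G₀∣≡∣lucas∣ n with G₀-lucas n
  ... | σ , ∣σ∣≡1 , G₀[n] , _ = begin
    ∣ G₀ n ∣                        ≡⟨ cong ∣_∣ G₀[n] ⟩
    ∣ σ * lucas P Q n ∣             ≡⟨ ℤ.abs-* σ (lucas P Q n) ⟩
    ∣ σ ∣ ℕ.* ∣ lucas P Q n ∣       ≡⟨ cong (ℕ._* _) ∣σ∣≡1 ⟩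
    1 ℕ.* ∣ lucas P Q n ∣           ≡⟨ ℕ.*-identityˡ _ ⟩
    ∣ lucas P Q n ∣                 ∎
    where open ≡-Reasoning

∣-m⇒∣m : ∀ {k m} → k ∣ₛ - m → k ∣ₛ m
∣-m⇒∣m {k} {m} k∣-m = subst (k ∣ₛ_) (ℤ.neg-involutive m) (∣m⇒∣-m k∣-m)

∣m-n∣n⇒∣m : ∀ {k m n} → k ∣ₛ m - n → k ∣ₛ n → k ∣ₛ m
∣m-n∣n⇒∣m k∣m-n k∣n = ∣m+n∣n⇒∣m k∣m-n (∣m⇒∣-m k∣n)

record GcdFactorisation (w₁ w₀ : ℤ) : Set where
  field
    k     : ℕ
    a b   : ℤ
    k≢0   : k ≢ 0
    a⊥b   : Coprime ∣ a ∣ ∣ b ∣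
    w₁≡ak : w₁ ≡ a * + k
    w₀≡bk : w₀ ≡ b * + k

gcd-factorisation : ∀ w₁ w₀ → w₁ ≢ + 0 → GcdFactorisation w₁ w₀
gcd-factorisation w₁ w₀ w₁≢0 = record
  { k = k ; a = a ; b = b ; k≢0 = k≢0 ; w₁≡ak = w₁≡ak ; w₀≡bk = w₀≡bk
  ; a⊥b = subst₂ Coprime (∣quotient∣ a w₁≡ak) (∣quotient∣ b w₀≡bk)
            (coprime-/gcd ∣ w₁ ∣ ∣ w₀ ∣)
  }
  where
  k : ℕ
  k = gcd ∣ w₁ ∣ ∣ w₀ ∣
  k≢0 : k ≢ 0
  k≢0 = gcd[m,n]≢0 ∣ w₁ ∣ ∣ w₀ ∣
          (inj₁ (λ ∣w₁∣≡0 → w₁≢0 (ℤ.∣i∣≡0⇒i≡0 ∣w₁∣≡0)))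
  instance
    k-nonZero : ℕ.NonZero k
    k-nonZero = ℕ.≢-nonZero k≢0
  k∣w₁ : + k ∣ₛ w₁
  k∣w₁ = ∣ᵤ⇒∣ {+ k} {w₁} (gcd[m,n]∣m ∣ w₁ ∣ ∣ w₀ ∣)
  k∣w₀ : + k ∣ₛ w₀
  k∣w₀ = ∣ᵤ⇒∣ {+ k} {w₀} (gcd[m,n]∣n ∣ w₁ ∣ ∣ w₀ ∣)
  a b : ℤ
  a = _∣ₛ_.quotient k∣w₁
  b = _∣ₛ_.quotient k∣w₀
  w₁≡ak : w₁ ≡ a * + k
  w₁≡ak = _∣ₛ_.equality k∣w₁
  w₀≡bk : w₀ ≡ b * + k
  w₀≡bk = _∣ₛ_.equality k∣w₀
  ∣quotient∣ : ∀ {w} c → w ≡ c * + k → ∣ w ∣ ℕ./ k ≡ ∣ c ∣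
  ∣quotient∣ {w} c w≡ck = begin
    ∣ w ∣ ℕ./ k              ≡⟨ cong (λ z → ∣ z ∣ ℕ./ k) w≡ck ⟩
    ∣ c * + k ∣ ℕ./ k        ≡⟨ cong (ℕ._/ k) (ℤ.abs-* c (+ k)) ⟩
    ∣ c ∣ ℕ.* k ℕ./ k        ≡⟨ ℕ.m*n/n≡m ∣ c ∣ k ⟩
    ∣ c ∣                    ∎
    where open ≡-Reasoning

module PrimeDivisor {p : ℕ} (p-prime : Prime p) where

  p≢1 : p ≢ 1
  p≢1 = ℕ.nonTrivial⇒≢1 {{prime⇒nonTrivial p-prime}}

  euclid : ∀ {a b} → + p ∣ₛ a * b → + p ∣ₛ a ⊎ + p ∣ₛ b
  euclid {a} {b} p∣ab = Sum.map (∣ᵤ⇒∣ {+ p} {a}) (∣ᵤ⇒∣ {+ p} {b})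
    (euclidsLemma ∣ a ∣ ∣ b ∣ p-prime (subst (p ℕ.∣_) (ℤ.abs-* a b) (∣⇒∣ᵤ p∣ab)))

  Primitive : ℤ² → Set
  Primitive (w₁ , w₀) = ¬ (+ p ∣ₛ w₁ × + p ∣ₛ w₀)

  coprime⇒primitive : ∀ {a b} → Coprime ∣ a ∣ ∣ b ∣ → Primitive (a , b)
  coprime⇒primitive a⊥b (p∣a , p∣b) = p≢1 (a⊥b (∣⇒∣ᵤ p∣a , ∣⇒∣ᵤ p∣b))

  ∣₀-proportional : ∀ {u v a b w₁ w₀} → u * a ≡ w₁ * v → u * b ≡ w₀ * v →
                    Primitive (u , v) → Primitive (a , b) → + p ∣ₛ b → + p ∣ₛ w₀
  ∣₀-proportional {u} {v} {a} {b} {w₁} {w₀} ua≡w₁v ub≡w₀v uv-prim ab-prim p∣b =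
    [ id , (λ p∣v → ⊥-elim (p∤v p∣v)) ]′
      (euclid (subst (+ p ∣ₛ_) ub≡w₀v (∣n⇒∣m*n u p∣b)))
    where
    p∤v : ¬ (+ p ∣ₛ v)
    p∤v p∣v = [ (λ p∣u → uv-prim (p∣u , p∣v)) , (λ p∣a → ab-prim (p∣a , p∣b)) ]′
                (euclid (subst (+ p ∣ₛ_) (sym ua≡w₁v) (∣n⇒∣m*n w₁ p∣v)))

  InGfp-resp-∼ : ∀ {x y} → x ∼ y → InGfp p y → InGfp p x
  InGfp-resp-∼ x∼y (a , b , a⊥b , y∼ab , p∣b) = a , b , a⊥b , ∼-trans x∼y y∼ab , p∣b

  InGfp-embed⇒∣₀ : ∀ W → InGfp p (embed W) → + p ∣ₛ proj₂ W
  InGfp-embed⇒∣₀ (w₁ , w₀)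
                 (a , b , a⊥b , (d@(ℚ.mkℚ _ _ d-coprime) , _ , ιw₁≡ , ιw₀≡) , p∣b) =
    ∣₀-proportional {↥ d} {↧ d} {a} {b} {w₁} {w₀}
      (ι-cross d a w₁ (sym ιw₁≡)) (ι-cross d b w₀ (sym ιw₀≡))
      (coprime⇒primitive (Coprimality.recompute d-coprime)) (coprime⇒primitive a⊥b)
      (∣ᵤ⇒∣ {+ p} {b} p∣b)

  InGfp-embed⇐ : ∀ W → Primitive W → + p ∣ₛ proj₂ W → InGfp p (embed W)
  InGfp-embed⇐ (w₁ , w₀) W-prim p∣w₀ =
    a , b , a⊥b , ·⇒∼ ιk≢0 (cong₂ _,_ (ι-split a w₁≡ak) (ι-split b w₀≡bk)) , ∣⇒∣ᵤ p∣b
    where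
    p∤w₁ : ¬ (+ p ∣ₛ w₁)
    p∤w₁ p∣w₁ = W-prim (p∣w₁ , p∣w₀)
    open GcdFactorisation (gcd-factorisation w₁ w₀
      (λ w₁≡0 → p∤w₁ (subst (+ p ∣ₛ_) (sym w₁≡0) (divides (+ 0) refl))))
    ιk≢0 : ι (+ k) ≢ 0ℚ
    ιk≢0 ιk≡0 = k≢0 (cong ∣_∣ (ι-injective {+ k} {+ 0} ιk≡0))
    ι-split : ∀ c {w} → w ≡ c * + k → ι w ≡ ι (+ k) ℚ.* ι c
    ι-split c refl = trans (ι-homo-* c (+ k)) (ℚ.*-comm (ι c) (ι (+ k)))
    p∣b : + p ∣ₛ b
    p∣b = [ id , (λ p∣k → ⊥-elim (p∤w₁ (subst (+ p ∣ₛ_) (sym w₁≡ak) (∣n⇒∣m*n a p∣k)))) ]′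
            (euclid (subst (+ p ∣ₛ_) w₀≡bk p∣w₀))

  InGfp⇔∣₀ : ∀ {x W} → x ∼ embed W → Primitive W → InGfp p x ⇔ + p ∣ₛ proj₂ W
  InGfp⇔∣₀ {W = W} x∼W W-prim = mk⇔
    (λ x∈Gfp → InGfp-embed⇒∣₀ W (InGfp-resp-∼ (∼-sym x∼W) x∈Gfp))
    (λ p∣w₀ → InGfp-resp-∼ x∼W (InGfp-embed⇐ W W-prim p∣w₀))

module ModP (P Q : ℤ) (Q≢0 : Q ≢ + 0)
            {p : ℕ} (p-prime : Prime p) (p∤Q : ¬ (+ p ∣ₛ Q)) where
  open Lucas P Q
  open PrimeDivisor p-prime

  G-primitive : ∀ n → Primitive (G n)
  G-primitive zero    (p∣1 , _) = p≢1 (ℕ.∣1⇒≡1 (∣⇒∣ᵤ p∣1))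
  G-primitive (suc n) p∣Gₙ₊₁
    with subst (λ X → + p ∣ₛ proj₁ X × + p ∣ₛ proj₂ X) (gℤ-mulℤ (G n)) p∣Gₙ₊₁
  ... | p∣-QG₀ , p∣G₁-PG₀ = G-primitive n (p∣G₁ , p∣G₀)
    where
    p∣G₀ : + p ∣ₛ G₀ n
    p∣G₀ = [ (λ p∣Q → ⊥-elim (p∤Q p∣Q)) , id ]′ (euclid (∣-m⇒∣m p∣-QG₀))
    p∣G₁ : + p ∣ₛ G₁ n
    p∣G₁ = ∣m-n∣n⇒∣m p∣G₁-PG₀ (∣n⇒∣m*n P p∣G₀)

  conjℤ-primitive : ∀ {W} → Primitive W → Primitive (conjℤ W)
  conjℤ-primitive {w₁ , w₀} W-prim (p∣w₁-Pw₀ , p∣-w₀) = W-prim (p∣w₁ , p∣w₀)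
    where
    p∣w₀ : + p ∣ₛ w₀
    p∣w₀ = ∣-m⇒∣m p∣-w₀
    p∣w₁ : + p ∣ₛ w₁
    p∣w₁ = ∣m-n∣n⇒∣m p∣w₁-Pw₀ (∣n⇒∣m*n P p∣w₀)

  ∣₀-conjℤ : ∀ W → + p ∣ₛ proj₂ (conjℤ W) ⇔ + p ∣ₛ proj₂ W
  ∣₀-conjℤ _ = mk⇔ ∣-m⇒∣m ∣m⇒∣-m

  InGfp⇔∣G₀ : ∀ n {x} → x ∼ pow P Q g n ^±1 → InGfp p x ⇔ + p ∣ₛ G₀ n
  InGfp⇔∣G₀ n {x} (inj₁ x∼gⁿ) = InGfp⇔∣₀ (subst (x ∼_) (pow-g n) x∼gⁿ) (G-primitive n)
  InGfp⇔∣G₀ n {x} (inj₂ xgⁿ∼one) =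
    ∣₀-conjℤ (G n) ⇔-∘ InGfp⇔∣₀ x∼conjGⁿ (conjℤ-primitive (G-primitive n))
    where
    x∼conjGⁿ : x ∼ embed (conjℤ (G n))
    x∼conjGⁿ = subst (x ∼_) (trans (cong conj (pow-g n)) (embed-conj (G n)))
                 (mul∼one⇒∼conj xgⁿ∼one (norm-pow-g≢0 Q≢0 n))

  -- Modulo p the w₀-coordinate of X Y is X₁ Y₀ once p ∣ X₀.
  ∣₀-mulℤ : ∀ {X} Y → Primitive X → + p ∣ₛ proj₂ X →
            + p ∣ₛ proj₂ (mulℤ X Y) ⇔ + p ∣ₛ proj₂ Y
  ∣₀-mulℤ {x₁ , x₀} (y₁ , y₀) X-prim p∣x₀ = mk⇔
    (λ p∣XY₀ → [ (λ p∣x₁ → ⊥-elim (X-prim (p∣x₁ , p∣x₀))) , id ]′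
                 (euclid (∣m+n∣n⇒∣m (subst (+ p ∣ₛ_) split p∣XY₀) p∣tail)))
    (λ p∣y₀ → subst (+ p ∣ₛ_) (sym split) (∣m∣n⇒∣m+n (∣n⇒∣m*n x₁ p∣y₀) p∣tail))
    where
    split : (x₀ * y₁ + x₁ * y₀) - P * x₀ * y₀ ≡ x₁ * y₀ + x₀ * (y₁ - P * y₀)
    split = identity P x₀ x₁ y₀ y₁
      where
      identity : ∀ P x₀ x₁ y₀ y₁ →
                 (x₀ * y₁ + x₁ * y₀) - P * x₀ * y₀ ≡ x₁ * y₀ + x₀ * (y₁ - P * y₀)
      identity = ℤ.solve-∀
    p∣tail : + p ∣ₛ x₀ * (y₁ - P * y₀)
    p∣tail = ∣m⇒∣m*n (y₁ - P * y₀) p∣x₀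

  ∣G₀-shift : ∀ m n → + p ∣ₛ G₀ m → + p ∣ₛ G₀ (m ℕ.+ n) ⇔ + p ∣ₛ G₀ n
  ∣G₀-shift m n p∣G₀[m] =
    subst (λ X → + p ∣ₛ proj₂ X ⇔ + p ∣ₛ G₀ n) (sym (powℤ-+ gℤ m n))
      (∣₀-mulℤ (G n) (G-primitive m) p∣G₀[m])

  ∣G₀⇔∣lucas : ∀ n → + p ∣ₛ G₀ n ⇔ + p ∣ lucas P Q n
  ∣G₀⇔∣lucas n = mk⇔
    (λ p∣G₀ → subst (p ℕ.∣_) (∣G₀∣≡∣lucas∣ n) (∣⇒∣ᵤ p∣G₀))
    (λ p∣F → ∣ᵤ⇒∣ {+ p} {G₀ n} (subst (p ℕ.∣_) (sym (∣G₀∣≡∣lucas∣ n)) p∣F))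

  module Rank (r : ℕ) (r-rank : IsRank P Q p r) where

    instance
      r-nonZero : ℕ.NonZero r
      r-nonZero = ℕ.>-nonZero (proj₁ r-rank)

    ∣G₀-multiple : ∀ q → + p ∣ₛ G₀ (q ℕ.* r)
    ∣G₀-multiple zero    = divides (+ 0) refl
    ∣G₀-multiple (suc q) =
      Equivalence.from (∣G₀-shift r (q ℕ.* r) p∣G₀[r]) (∣G₀-multiple q)
      where
      p∣G₀[r] : + p ∣ₛ G₀ r
      p∣G₀[r] = Equivalence.from (∣G₀⇔∣lucas r) (proj₁ (proj₂ r-rank))

    ∣G₀-below-rank : ∀ s → s ℕ.< r → + p ∣ₛ G₀ s → s ≡ 0
    ∣G₀-below-rank zero    _   _    = refl
    ∣G₀-below-rank (suc s) s<r p∣G₀ =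
      ⊥-elim (proj₂ (proj₂ r-rank) (suc s) (s≤s z≤n) s<r
                (Equivalence.to (∣G₀⇔∣lucas (suc s)) p∣G₀))

    ∣G₀⇒rank∣ : ∀ n → + p ∣ₛ G₀ n → r ℕ.∣ n
    ∣G₀⇒rank∣ n p∣G₀ =
      ℕ.m%n≡0⇒n∣m n r (∣G₀-below-rank (n ℕ.% r) (ℕ.m%n<n n r) p∣G₀[n%r])
      where
      n≡qr+s : n ≡ (n ℕ./ r) ℕ.* r ℕ.+ n ℕ.% r
      n≡qr+s = trans (ℕ.m≡m%n+[m/n]*n n r) (ℕ.+-comm (n ℕ.% r) ((n ℕ./ r) ℕ.* r))
      p∣G₀[n%r] : + p ∣ₛ G₀ (n ℕ.% r)
      p∣G₀[n%r] =
        Equivalence.to (∣G₀-shift ((n ℕ./ r) ℕ.* r) (n ℕ.% r) (∣G₀-multiple (n ℕ./ r)))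
          (subst (λ m → + p ∣ₛ G₀ m) n≡qr+s p∣G₀)

    rank∣⇒∣G₀ : ∀ {n} → r ℕ.∣ n → + p ∣ₛ G₀ n
    rank∣⇒∣G₀ (ℕ.divides q refl) = ∣G₀-multiple q

    ∣G₀⇔rank∣ : ∀ n → + p ∣ₛ G₀ n ⇔ r ℕ.∣ n
    ∣G₀⇔rank∣ n = mk⇔ (∣G₀⇒rank∣ n) rank∣⇒∣G₀

lemma3 : (P Q : ℤ) → ¬ (Q ≡ + 0) → ¬ (P * P - (+ 4) * Q ≡ + 0) →
    (p : ℕ) → Prime p → ¬ ((+ p) ∣ Q) →
    (r : ℕ) → IsRank P Q p r →
    (x : Pair) → ¬ (norm P Q x ≡ 0ℚ) →
    (InGfp p x × InCyclic P Q (0ℚ , 1ℚ) x)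
    ⇔ InCyclic P Q (pow P Q (0ℚ , 1ℚ) r) x
lemma3 P Q Q≢0 _ p p-prime p∤Q r r-rank x _ = mk⇔ to from
  where
  open Lucas P Q
  open ModP P Q Q≢0 p-prime (λ p∣Q → p∤Q (∣⇒∣ᵤ p∣Q))
  open Rank r r-rank

  InGfp⇔rank∣ : ∀ n → x ∼ pow P Q g n ^±1 → InGfp p x ⇔ r ℕ.∣ n
  InGfp⇔rank∣ n x∼gⁿ = ∣G₀⇔rank∣ n ⇔-∘ InGfp⇔∣G₀ n x∼gⁿ

  to : InGfp p x × InCyclic P Q g x → InCyclic P Q (pow P Q g r) x
  to (x∈Gfp , n , x∼gⁿ) =
    q , subst (x ∼_^±1) (trans (cong (pow P Q g) n≡qr) (sym (pow-pow-g r q))) x∼gⁿ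
    where
    open ℕ._∣_ (Equivalence.to (InGfp⇔rank∣ n x∼gⁿ) x∈Gfp)
      renaming (quotient to q; equality to n≡qr)

  from : InCyclic P Q (pow P Q g r) x → InGfp p x × InCyclic P Q g x
  from (q , x∼gʳ^q) =
    Equivalence.from (InGfp⇔rank∣ (q ℕ.* r) x∼gᵠʳ) (ℕ.divides q refl) , q ℕ.* r , x∼gᵠʳ
    where
    x∼gᵠʳ : x ∼ pow P Q g (q ℕ.* r) ^±1
    x∼gᵠʳ = subst (x ∼_^±1) (pow-pow-g r q) x∼gʳ^q
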